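{- Let $n\ge1$, $\nu\ge1$ be integers, $\delta\in\{0,1,2\}$, and let $\pi:\mathbb{Z}_{2^n}\to\mathbb{Z}_2$ be reduction modulo $2$, applied componentwise to tuples. Then: (1) If $[\vec a]$ is a vertex of $\mathcal{O}^{(2\nu+\delta)}_{2^n}$, then $|\{[\vec b]\in\mathcal{V}(\mathcal{O}^{(2\nu+\delta)}_{2^n}) : [\pi(\vec a)]=[\pi(\vec b)]\}| = 2^{(n-1)(2\nu+\delta-2)}$. (2) $[\vec a]$ and $[\vec b]$ are adjacent vertices in $\mathcal{O}^{(2\nu+\delta)}_{2^n}$ if and only if $[\pi(\vec a)]$ and $[\pi(\vec b)]$ are adjacent vertices in $\mathcal{O}^{(2\nu+\delta)}_{2}$. (3) If $[\pi(\vec a)]$ and $[\pi(\vec b)]$ are adjacent vertices in $\mathcal{O}^{(2\nu+\delta)}_{2}$, then $[\vec a+\vec m_1]$ and $[\vec b+\vec m_2]$ are adjacent vertices in $\mathcal{O}^{(2\nu+\delta)}_{2^n}$ for all $\vec m_1,\vec m_2\in(2\mathbb{Z}_{2^n})^{2\nu+\delta}$ such that $(\vec a+\vec m_1)G_{2\nu+\delta,\Delta}(\vec a+\vec m_1)^t=(\vec b+\vec m_2)G_{2\nu+\delta,\Delta}(\vec b+\vec m_2)^t=0$.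
   Context: For integers $k\ge1$, $\nu\ge 1$ and $\delta\in\{0,1,2\}$, let $V^{2\nu+\delta}$ be the set of tuples $\vec a=(a_1,\ldots,a_{2\nu+\delta})\in\mathbb{Z}_{2^k}^{2\nu+\delta}$ such that some $a_i$ is a unit of $\mathbb{Z}_{2^k}$. Write $\vec a\sim\vec b$ if $\vec a=\lambda\vec b$ for some $\lambda\in\mathbb{Z}_{2^k}^\times$, and let $[\vec a]$ denote the class of $\vec a$. Let $G_{2\nu+\delta,\Delta}$ be the block diagonal matrix over $\mathbb{Z}_{2^k}$ whose first block is $\begin{pmatrix}0&I_\nu\\0&0\end{pmatrix}$ and whose second block is $\Delta$, where $\Delta$ is absent if $\delta=0$, $\Delta=(1)$ if $\delta=1$, and $\Delta=\begin{pmatrix}z&1\\0&z\end{pmatrix}$ if $\delta=2$, with $z$ a fixed unit of $\mathbb{Z}_{2^k}$ (for $k=1$, $z=1$, the reduction of the fixed unit). The orthogonal graph $\mathcal{O}^{(2\nu+\delta)}_{2^k}$ has vertex set $\mathcal{V}(\mathcal{O}^{(2\nu+\delta)}_{2^k})=\{[\vec a]: \vec a\in V^{2\nu+\delta},\ \vec a G_{2\nu+\delta,\Delta}\vec a^t=0\}$, and $[\vec a]$ is adjacent to $[\vec b]$ iff $\vec a(G_{2\nu+\delta,\Delta}+G_{2\nu+\delta,\Delta}^t)\vec b^t\in\mathbb{Z}_{2^k}^\times$. The graph $\mathcal{O}^{(2\nu+\delta)}_2$ is the case $k=1$; the matrix over $\mathbb{Z}_2$ is the reduction of the one over $\mathbb{Z}_{2^n}$.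 -}

module Defs where

open import Data.Nat using (ℕ; zero; suc; _^_; _<ᵇ_; _≡ᵇ_; NonZero)
import Data.Nat as N
open import Data.Nat.Properties using (m^n≢0)
open import Data.Nat.DivMod using (_mod_)
open import Data.Fin using (Fin; toℕ)
import Data.Fin as F
open import Data.Bool using (Bool; true; false; if_then_else_; _∧_)
open import Data.Product using (Σ; ∃; _×_; _,_)
open import Relation.Binary.PropositionalEquality using (_≡_)

-- The ring ℤ_{2^k}, elements represented by Fin (2 ^ k), arithmetic mod 2 ^ k.

record Z (k : ℕ) : Set where
  constructor ⟨_⟩
  field val : Fin (2 ^ k)
open Z public

fromNat : (k : ℕ) → ℕ → Z k
fromNat k x = ⟨ _mod_ x (2 ^ k) {{m^n≢0 2 k}} ⟩

zeroZ : (k : ℕ) → Z k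
zeroZ k = fromNat k 0

oneZ : (k : ℕ) → Z k
oneZ k = fromNat k 1

addZ : {k : ℕ} → Z k → Z k → Z k
addZ {k} a b = fromNat k (toℕ (val a) N.+ toℕ (val b))

mulZ : {k : ℕ} → Z k → Z k → Z k
mulZ {k} a b = fromNat k (toℕ (val a) N.* toℕ (val b))

IsUnit : {k : ℕ} → Z k → Set
IsUnit {k} a = ∃ λ b → mulZ a b ≡ oneZ k

π : {k : ℕ} → Z k → Z 1
π a = fromNat 1 (toℕ (val a))

Tup : ℕ → ℕ → Set
Tup k d = Fin d → Z k

πv : {k d : ℕ} → Tup k d → Tup 1 d
πv a i = π (a i)

addV : {k d : ℕ} → Tup k d → Tup k d → Tup k d
addV a b i = addZ (a i) (b i)

sumZ : {k : ℕ} (d : ℕ) → (Fin d → Z k) → Z k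
sumZ {k} zero f = zeroZ k
sumZ (suc d) f = addZ (f F.zero) (sumZ d (λ i → f (F.suc i)))

InV : {k d : ℕ} → Tup k d → Set
InV a = ∃ λ i → IsUnit (a i)

_∼_ : {k d : ℕ} → Tup k d → Tup k d → Set
a ∼ b = ∃ λ l → IsUnit l × (∀ i → a i ≡ mulZ l (b i))

-- the matrix G_{2ν+δ,Δ} with parameter z (the unit in Δ for δ = 2)
-- entries indexed by i, j < 2ν+δ (as naturals):
--   G i j = 1   if i < ν and j = i + ν
--   for i, j ≥ 2ν :  δ = 1 : G 2ν 2ν = 1
--                    δ = 2 : G i i = z , G 2ν (2ν+1) = 1
--   otherwise 0
Gmat : (k ν δ : ℕ) → Z k → Fin (2 N.* ν N.+ δ) → Fin (2 N.* ν N.+ δ) → Z k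
Gmat k ν δ z i j =
  let i' = toℕ i ; j' = toℕ j ; tν = 2 N.* ν in
  if (i' <ᵇ ν) ∧ (j' ≡ᵇ (i' N.+ ν)) then oneZ k
  else if (i' <ᵇ tν) then zeroZ k
  else if (j' <ᵇ tν) then zeroZ k
  else if (δ ≡ᵇ 1) then (if i' ≡ᵇ j' then oneZ k else zeroZ k)
  else if (i' ≡ᵇ j') then z
  else if (j' ≡ᵇ suc i') then oneZ k
  else zeroZ k

Qform : (k ν δ : ℕ) → Z k → Tup k (2 N.* ν N.+ δ) → Z k
Qform k ν δ z a =
  sumZ _ (λ i → sumZ _ (λ j → mulZ (a i) (mulZ (Gmat k ν δ z i j) (a j))))

Bform : (k ν δ : ℕ) → Z k → Tup k (2 N.* ν N.+ δ) → Tup k (2 N.* ν N.+ δ) → Z k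
Bform k ν δ z a b =
  sumZ _ (λ i → sumZ _ (λ j →
    mulZ (a i) (mulZ (addZ (Gmat k ν δ z i j) (Gmat k ν δ z j i)) (b j))))

IsVertex : (k ν δ : ℕ) → Z k → Tup k (2 N.* ν N.+ δ) → Set
IsVertex k ν δ z a = InV a × Qform k ν δ z a ≡ zeroZ k

AdjVertices : (k ν δ : ℕ) → Z k → Tup k (2 N.* ν N.+ δ) → Tup k (2 N.* ν N.+ δ) → Set
AdjVertices k ν δ z a b =
  IsVertex k ν δ z a × IsVertex k ν δ z b × IsUnit (Bform k ν δ z a b)

-- The set of ∼-classes of tuples satisfying P has exactly N elements:
-- there is a system of N pairwise inequivalent representatives in P
-- such that every element of P is equivalent to one of them.
NumClasses : {k d : ℕ} → (Tup k d → Set) → ℕ → Set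
NumClasses {k} {d} P N =
  Σ (Fin N → Tup k d) λ r →
    (∀ m → P (r m)) ×
    (∀ m l → r m ∼ r l → m ≡ l) ×
    (∀ b → P b → ∃ λ m → b ∼ r m)

IsEven : {k : ℕ} → Z k → Set
IsEven {k} a = ∃ λ c → a ≡ mulZ (fromNat k 2) c

module Submission where

-- π : ℤ/2^k → ℤ/2 is a ring homomorphism under which a residue is a unit iff
-- its image is 1.  Since Q(v) = v G vᵗ and the adjacency form are polynomial in
-- the entries, and π sends the Gram matrix over ℤ/2^k to the one over ℤ/2,
-- parts (2) and (3) follow at once: adjacency only asks for a unit value.
--
-- For part (1) let [a] be a vertex.  Modulo 2 the block Δ is anisotropic, so a
-- has a unit coordinate i among the 2ν hyperbolic ones.  Its hyperbolic partner
-- j satisfies Q(v + x e_j) = Q(v) + x v_i, so for v_i = a_i the j-th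
-- coordinate of an isotropic v is determined by the others.  Hence the classes
-- lying over [π a] correspond, after scaling to b_i = a_i, to the choices of
-- the d - 2 coordinates other than i, j among the lifts a_p + 2h, h < 2^(k-1):
-- there are 2^((k-1)(d-2)) of them.

open import Defs
open import Data.Nat as ℕ using (ℕ; _%_; _∸_; NonZero; _<ᵇ_; _≡ᵇ_)
import Data.Nat.Properties as ℕP
open import Data.Nat.DivMod using (_/_; m<n⇒m%n≡m; %-distribˡ-+; %-distribˡ-*; m*n%n≡0;
  m∣n⇒o%n%m≡o%m; m≡m%n+[m/n]*n; [m+kn]%n≡m%n; m<n*o⇒m/o<n)
open import Data.Nat.Divisibility using (_∣_; divides)
open import Data.Bool using (true; false; if_then_else_; _∧_)
open import Data.Bool.Properties using (T-≡; ¬-not; ∧-zeroʳ; if-float)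
open import Data.Fin as Fin using (Fin; toℕ; zero; suc; _↑ˡ_; _↑ʳ_; punchIn; punchOut)
import Data.Fin.Properties as FinP
open import Data.Vec.Functional using (updateAt)
import Data.Vec.Functional.Properties as VecP
open import Data.Product using (∃; _×_; _,_; proj₁; proj₂)
open import Data.Sum using (_⊎_; inj₁; inj₂)
open import Data.Empty using (⊥-elim)
open import Function using (_∘_)
open import Function.Bundles using (Equivalence; _⇔_; mk⇔)
open import Relation.Nullary using (Dec; yes; no)
open import Relation.Binary.PropositionalEquality
open import Algebra.Bundles using (CommutativeRing)
open import Algebra.Structures using (IsCommutativeRing)

-- The residue ring ℤ/2^k.  The map fromNat : ℕ → Z k is a surjective
-- semiring homomorphism, so every semiring law of ℕ is inherited by Z k.
module Residues (k : ℕ) where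

  instance
    2^k≢0 : NonZero (2 ℕ.^ k)
    2^k≢0 = ℕP.m^n≢0 2 k

  ∣_∣ : Z k → ℕ
  ∣ a ∣ = toℕ (val a)

  ∣fromNat∣ : ∀ x → ∣ fromNat k x ∣ ≡ x % 2 ℕ.^ k
  ∣fromNat∣ x = FinP.toℕ-fromℕ< _

  residue-ext : {a b : Z k} → ∣ a ∣ ≡ ∣ b ∣ → a ≡ b
  residue-ext {⟨ _ ⟩} {⟨ _ ⟩} e = cong ⟨_⟩ (FinP.toℕ-injective e)

  fromNat-cong : ∀ {x y} → x % 2 ℕ.^ k ≡ y % 2 ℕ.^ k → fromNat k x ≡ fromNat k y
  fromNat-cong {x} {y} e = residue-ext (trans (∣fromNat∣ x) (trans e (sym (∣fromNat∣ y))))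

  fromNat-∣∣ : ∀ a → fromNat k ∣ a ∣ ≡ a
  fromNat-∣∣ a = residue-ext (trans (∣fromNat∣ ∣ a ∣) (m<n⇒m%n≡m (FinP.toℕ<n (val a))))

  infixl 6 _+_
  infixl 7 _*_
  _+_ _*_ : Z k → Z k → Z k
  _+_ = addZ
  _*_ = mulZ

  0# 1# : Z k
  0# = zeroZ k
  1# = oneZ k

  -_ : Z k → Z k
  - a = fromNat k ((2 ℕ.^ k ∸ 1) ℕ.* ∣ a ∣)

  fromNat-+ : ∀ x y → fromNat k x + fromNat k y ≡ fromNat k (x ℕ.+ y)
  fromNat-+ x y = begin
    fromNat k (∣ fromNat k x ∣ ℕ.+ ∣ fromNat k y ∣)
      ≡⟨ cong₂ (λ u v → fromNat k (u ℕ.+ v)) (∣fromNat∣ x) (∣fromNat∣ y) ⟩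
    fromNat k (x % 2 ℕ.^ k ℕ.+ y % 2 ℕ.^ k)
      ≡⟨ fromNat-cong (sym (%-distribˡ-+ x y _)) ⟩
    fromNat k (x ℕ.+ y) ∎
    where open ≡-Reasoning

  fromNat-* : ∀ x y → fromNat k x * fromNat k y ≡ fromNat k (x ℕ.* y)
  fromNat-* x y = begin
    fromNat k (∣ fromNat k x ∣ ℕ.* ∣ fromNat k y ∣)
      ≡⟨ cong₂ (λ u v → fromNat k (u ℕ.* v)) (∣fromNat∣ x) (∣fromNat∣ y) ⟩
    fromNat k ((x % 2 ℕ.^ k) ℕ.* (y % 2 ℕ.^ k))
      ≡⟨ fromNat-cong (sym (%-distribˡ-* x y _)) ⟩
    fromNat k (x ℕ.* y) ∎
    where open ≡-Reasoning

  residue-ind : {P : Z k → Set} → (∀ x → P (fromNat k x)) → ∀ a → P a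
  residue-ind {P} h a = subst P (fromNat-∣∣ a) (h ∣ a ∣)

  module Laws where
    open ≡-Reasoning

    +-assoc : ∀ a b c → (a + b) + c ≡ a + (b + c)
    +-assoc = residue-ind λ x → residue-ind λ y → residue-ind λ z → begin
      fromNat k x + fromNat k y + fromNat k z  ≡⟨ cong (_+ fromNat k z) (fromNat-+ x y) ⟩
      fromNat k (x ℕ.+ y) + fromNat k z        ≡⟨ fromNat-+ (x ℕ.+ y) z ⟩
      fromNat k (x ℕ.+ y ℕ.+ z)                ≡⟨ cong (fromNat k) (ℕP.+-assoc x y z) ⟩
      fromNat k (x ℕ.+ (y ℕ.+ z))              ≡⟨ fromNat-+ x (y ℕ.+ z) ⟨
      fromNat k x + fromNat k (y ℕ.+ z)        ≡⟨ cong (fromNat k x +_) (fromNat-+ y z) ⟨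
      fromNat k x + (fromNat k y + fromNat k z) ∎

    *-assoc : ∀ a b c → (a * b) * c ≡ a * (b * c)
    *-assoc = residue-ind λ x → residue-ind λ y → residue-ind λ z → begin
      fromNat k x * fromNat k y * fromNat k z  ≡⟨ cong (_* fromNat k z) (fromNat-* x y) ⟩
      fromNat k (x ℕ.* y) * fromNat k z        ≡⟨ fromNat-* (x ℕ.* y) z ⟩
      fromNat k (x ℕ.* y ℕ.* z)                ≡⟨ cong (fromNat k) (ℕP.*-assoc x y z) ⟩
      fromNat k (x ℕ.* (y ℕ.* z))              ≡⟨ fromNat-* x (y ℕ.* z) ⟨
      fromNat k x * fromNat k (y ℕ.* z)        ≡⟨ cong (fromNat k x *_) (fromNat-* y z) ⟨
      fromNat k x * (fromNat k y * fromNat k z) ∎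

    +-comm : ∀ a b → a + b ≡ b + a
    +-comm = residue-ind λ x → residue-ind λ y →
      trans (fromNat-+ x y) (trans (cong (fromNat k) (ℕP.+-comm x y)) (sym (fromNat-+ y x)))

    *-comm : ∀ a b → a * b ≡ b * a
    *-comm = residue-ind λ x → residue-ind λ y →
      trans (fromNat-* x y) (trans (cong (fromNat k) (ℕP.*-comm x y)) (sym (fromNat-* y x)))

    +-identityˡ : ∀ a → 0# + a ≡ a
    +-identityˡ = residue-ind λ x → fromNat-+ 0 x

    *-identityˡ : ∀ a → 1# * a ≡ a
    *-identityˡ = residue-ind λ x → trans (fromNat-* 1 x) (cong (fromNat k) (ℕP.*-identityˡ x))

    distribʳ : ∀ a b c → (b + c) * a ≡ b * a + c * a
    distribʳ = residue-ind λ x → residue-ind λ y → residue-ind λ z → begin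
      (fromNat k y + fromNat k z) * fromNat k x     ≡⟨ cong (_* fromNat k x) (fromNat-+ y z) ⟩
      fromNat k (y ℕ.+ z) * fromNat k x             ≡⟨ fromNat-* (y ℕ.+ z) x ⟩
      fromNat k ((y ℕ.+ z) ℕ.* x)                   ≡⟨ cong (fromNat k) (ℕP.*-distribʳ-+ x y z) ⟩
      fromNat k (y ℕ.* x ℕ.+ z ℕ.* x)               ≡⟨ fromNat-+ (y ℕ.* x) (z ℕ.* x) ⟨
      fromNat k (y ℕ.* x) + fromNat k (z ℕ.* x)     ≡⟨ cong₂ _+_ (fromNat-* y x) (fromNat-* z x) ⟨
      fromNat k y * fromNat k x + fromNat k z * fromNat k x ∎

    -‿inverseˡ : ∀ a → (- a) + a ≡ 0#
    -‿inverseˡ a = begin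
      - a + a                                            ≡⟨ cong (- a +_) (fromNat-∣∣ a) ⟨
      fromNat k ((2 ℕ.^ k ∸ 1) ℕ.* ∣ a ∣) + fromNat k ∣ a ∣ ≡⟨ fromNat-+ _ ∣ a ∣ ⟩
      fromNat k ((2 ℕ.^ k ∸ 1) ℕ.* ∣ a ∣ ℕ.+ ∣ a ∣)       ≡⟨ cong (fromNat k) (ℕP.+-comm _ ∣ a ∣) ⟩
      fromNat k (ℕ.suc (2 ℕ.^ k ∸ 1) ℕ.* ∣ a ∣)           ≡⟨ cong (λ m → fromNat k (m ℕ.* ∣ a ∣)) (ℕP.suc-pred (2 ℕ.^ k)) ⟩
      fromNat k (2 ℕ.^ k ℕ.* ∣ a ∣)                       ≡⟨ fromNat-cong multiple≡0 ⟩
      0#                                                 ∎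
      where
        multiple≡0 : (2 ℕ.^ k ℕ.* ∣ a ∣) % 2 ℕ.^ k ≡ 0 % 2 ℕ.^ k
        multiple≡0 = trans (cong (_% 2 ℕ.^ k) (ℕP.*-comm (2 ℕ.^ k) ∣ a ∣))
                           (trans (m*n%n≡0 ∣ a ∣ _) (sym (m*n%n≡0 0 _)))

    +-identityʳ : ∀ a → a + 0# ≡ a
    +-identityʳ a = trans (+-comm a 0#) (+-identityˡ a)

    *-identityʳ : ∀ a → a * 1# ≡ a
    *-identityʳ a = trans (*-comm a 1#) (*-identityˡ a)

    distribˡ : ∀ a b c → a * (b + c) ≡ a * b + a * c
    distribˡ a b c = trans (*-comm a (b + c)) (trans (distribʳ a b c) (cong₂ _+_ (*-comm b a) (*-comm c a)))

    -‿inverseʳ : ∀ a → a + (- a) ≡ 0#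
    -‿inverseʳ a = trans (+-comm a (- a)) (-‿inverseˡ a)

  open Laws public

  isCommutativeRing : IsCommutativeRing _≡_ _+_ _*_ -_ 0# 1#
  isCommutativeRing = record
    { isRing = record
      { +-isAbelianGroup = record
        { isGroup = record
          { isMonoid = record
            { isSemigroup = record
              { isMagma = record { isEquivalence = isEquivalence ; ∙-cong = cong₂ _+_ }
              ; assoc = +-assoc }
            ; identity = +-identityˡ , +-identityʳ }
          ; inverse = -‿inverseˡ , -‿inverseʳ
          ; ⁻¹-cong = cong -_ }
        ; comm = +-comm }
      ; *-cong = cong₂ _*_
      ; *-assoc = *-assoc
      ; *-identity = *-identityˡ , *-identityʳ
      ; distrib = distribˡ , distribʳ }
    ; *-comm = *-comm }

  ring : CommutativeRing _ _
  ring = record { isCommutativeRing = isCommutativeRing }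

  open import Algebra.Solver.Ring.NaturalCoefficients.Default (CommutativeRing.commutativeSemiring ring)
    public using (solve; _:+_; _:*_; _:=_)

  open CommutativeRing ring public using (zeroˡ; zeroʳ)

  open import Algebra.Properties.Group (CommutativeRing.+-group ring) public
    using (inverseˡ-unique; inverseʳ-unique; ∙-cancelˡ)

  unit-cancel : ∀ x y u w → u * w ≡ 1# → x * u ≡ y * u → x ≡ y
  unit-cancel x y u w uw≡1 xu≡yu = begin
    x             ≡⟨ *-identityʳ x ⟨
    x * 1#        ≡⟨ cong (x *_) uw≡1 ⟨
    x * (u * w)   ≡⟨ *-assoc x u w ⟨
    x * u * w     ≡⟨ cong (_* w) xu≡yu ⟩
    y * u * w     ≡⟨ *-assoc y u w ⟩
    y * (u * w)   ≡⟨ cong (y *_) uw≡1 ⟩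
    y * 1#        ≡⟨ *-identityʳ y ⟩
    y             ∎
    where open ≡-Reasoning

  linear-root : ∀ q u w → u * w ≡ 1# → q + (- q) * w * u ≡ 0#
  linear-root q u w uw≡1 = begin
    q + (- q) * w * u      ≡⟨ cong (q +_) (trans (*-assoc (- q) w u) (cong ((- q) *_) (trans (*-comm w u) uw≡1))) ⟩
    q + (- q) * 1#         ≡⟨ cong (q +_) (*-identityʳ (- q)) ⟩
    q + - q                ≡⟨ -‿inverseʳ q ⟩
    0#                     ∎
    where open ≡-Reasoning

  linear-unique : ∀ q x u w → u * w ≡ 1# → q + x * u ≡ 0# → x ≡ (- q) * w
  linear-unique q x u w uw≡1 e =
    unit-cancel x ((- q) * w) u w uw≡1
      (trans (inverseʳ-unique q (x * u) e) (sym (inverseʳ-unique q _ (linear-root q u w uw≡1))))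

  sum-cong : ∀ d {f g : Fin d → Z k} → (∀ p → f p ≡ g p) → sumZ d f ≡ sumZ d g
  sum-cong 0    f≗g = refl
  sum-cong (ℕ.suc d) f≗g = cong₂ _+_ (f≗g zero) (sum-cong d (f≗g ∘ suc))

  sum-+ : ∀ d (f g : Fin d → Z k) → sumZ d (λ p → f p + g p) ≡ sumZ d f + sumZ d g
  sum-+ 0      f g = sym (+-identityˡ 0#)
  sum-+ (ℕ.suc d) f g = trans (cong (f zero + g zero +_) (sum-+ d (f ∘ suc) (g ∘ suc)))
                              (interchange (f zero) (g zero) _ _)
    where interchange : ∀ a b c e → a + b + (c + e) ≡ a + c + (b + e)
          interchange = solve 4 (λ a b c e → a :+ b :+ (c :+ e) := a :+ c :+ (b :+ e)) refl

  sum-*ˡ : ∀ d c (f : Fin d → Z k) → sumZ d (λ p → c * f p) ≡ c * sumZ d f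
  sum-*ˡ 0      c f = sym (zeroʳ c)
  sum-*ˡ (ℕ.suc d) c f = trans (cong (c * f zero +_) (sum-*ˡ d c (f ∘ suc))) (sym (distribˡ c _ _))

  sum-zero : ∀ d (f : Fin d → Z k) → (∀ p → f p ≡ 0#) → sumZ d f ≡ 0#
  sum-zero 0      f f≗0 = refl
  sum-zero (ℕ.suc d) f f≗0 = trans (cong₂ _+_ (f≗0 zero) (sum-zero d (f ∘ suc) (f≗0 ∘ suc))) (+-identityˡ 0#)

  basis : ∀ {d} → Fin d → Fin d → Z k
  basis j p with p Fin.≟ j
  ... | yes _ = 1#
  ... | no  _ = 0#

  basis-same : ∀ {d} (j : Fin d) → basis j j ≡ 1#
  basis-same j with j Fin.≟ j
  ... | yes _ = refl
  ... | no j≢j = ⊥-elim (j≢j refl)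

  basis-other : ∀ {d} (j p : Fin d) → p ≢ j → basis j p ≡ 0#
  basis-other j p p≢j with p Fin.≟ j
  ... | yes p≡j = ⊥-elim (p≢j p≡j)
  ... | no  _   = refl

  sum-single : ∀ d (f : Fin d → Z k) j → (∀ p → p ≢ j → f p ≡ 0#) → sumZ d f ≡ f j
  sum-single (ℕ.suc d) f zero f≗0 =
    trans (cong (f zero +_) (sum-zero d (f ∘ suc) λ p → f≗0 (suc p) λ ())) (+-identityʳ (f zero))
  sum-single (ℕ.suc d) f (suc j) f≗0 =
    trans (cong₂ _+_ (f≗0 zero λ ()) (sum-single d (f ∘ suc) j λ p p≢j → f≗0 (suc p) (p≢j ∘ FinP.suc-injective)))
          (+-identityˡ (f (suc j)))

  sum-basis : ∀ d (f : Fin d → Z k) j → sumZ d (λ p → basis j p * f p) ≡ f j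
  sum-basis d f j = trans (sum-single d _ j λ p p≢j → trans (cong (_* f p) (basis-other j p p≢j)) (zeroˡ (f p)))
                          (trans (cong (_* f j) (basis-same j)) (*-identityˡ (f j)))

  sum-split : ∀ m n (f : Fin (m ℕ.+ n) → Z k) →
              sumZ (m ℕ.+ n) f ≡ sumZ m (λ p → f (p ↑ˡ n)) + sumZ n (λ p → f (m ↑ʳ p))
  sum-split 0         n f = sym (+-identityˡ _)
  sum-split (ℕ.suc m) n f = trans (cong (f zero +_) (sum-split m n (f ∘ suc))) (sym (+-assoc (f zero) _ _))

  module Bilinear {d : ℕ} (G : Fin d → Fin d → Z k) where
    open ≡-Reasoning

    bil : (Fin d → Z k) → (Fin d → Z k) → Z k
    bil u v = sumZ d (λ p → sumZ d (λ q → u p * (G p q * v q)))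

    bil-rows : ∀ u v → bil u v ≡ sumZ d (λ p → u p * sumZ d (λ q → G p q * v q))
    bil-rows u v = sum-cong _ λ p → sum-*ˡ d (u p) _

    bil-+ˡ : ∀ u u' v → bil (λ p → u p + u' p) v ≡ bil u v + bil u' v
    bil-+ˡ u u' v = trans (sum-cong _ λ p → trans (sum-cong _ λ q → distribʳ _ (u p) (u' p)) (sum-+ _ _ _))
                          (sum-+ _ _ _)

    bil-+ʳ : ∀ u v v' → bil u (λ q → v q + v' q) ≡ bil u v + bil u v'
    bil-+ʳ u v v' = trans (sum-cong _ λ p → trans (sum-cong _ λ q → expand (u p) (G p q) (v q) (v' q)) (sum-+ _ _ _))
                          (sum-+ _ _ _)
      where expand : ∀ a g b b' → a * (g * (b + b')) ≡ a * (g * b) + a * (g * b')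
            expand = solve 4 (λ a g b b' → a :* (g :* (b :+ b')) := a :* (g :* b) :+ a :* (g :* b')) refl

    bil-*ˡ : ∀ x u v → bil (λ p → x * u p) v ≡ x * bil u v
    bil-*ˡ x u v = trans (sum-cong _ λ p → trans (sum-cong _ λ q → *-assoc x (u p) _) (sum-*ˡ _ x _))
                         (sum-*ˡ _ x _)

    bil-*ʳ : ∀ x u v → bil u (λ q → x * v q) ≡ x * bil u v
    bil-*ʳ x u v = trans (sum-cong _ λ p → trans (sum-cong _ λ q → swap x (u p) (G p q) (v q)) (sum-*ˡ _ x _))
                         (sum-*ˡ _ x _)
      where swap : ∀ x a g b → a * (g * (x * b)) ≡ x * (a * (g * b))
            swap = solve 4 (λ x a g b → a :* (g :* (x :* b)) := x :* (a :* (g :* b))) refl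

    bil-basisˡ : ∀ j v → bil (basis j) v ≡ sumZ d (λ q → G j q * v q)
    bil-basisˡ j v = trans (bil-rows (basis j) v) (sum-basis d _ j)

    bil-basisʳ : ∀ j u → bil u (basis j) ≡ sumZ d (λ p → u p * G p j)
    bil-basisʳ j u = trans (bil-rows u (basis j)) (sum-cong _ λ p →
      cong (u p *_) (trans (sum-cong _ λ q → *-comm (G p q) _) (sum-basis d (G p) j)))

    bil-basis : ∀ j → bil (basis j) (basis j) ≡ G j j
    bil-basis j = trans (bil-basisˡ j (basis j)) (trans (sum-cong _ λ q → *-comm (G j q) _) (sum-basis d (G j) j))

    bil-line : ∀ v j x → let w = λ p → v p + x * basis j p in
      bil w w ≡ bil v v + x * (bil (basis j) v + bil v (basis j)) + x * x * G j j
    bil-line v j x = begin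
      bil (λ p → v p + x * e p) (λ p → v p + x * e p)
        ≡⟨ bil-+ˡ v (λ p → x * e p) _ ⟩
      bil v (λ p → v p + x * e p) + bil (λ p → x * e p) (λ p → v p + x * e p)
        ≡⟨ cong₂ _+_ (bil-+ʳ v v _) (trans (bil-*ˡ x e _) (cong (x *_) (bil-+ʳ e v _))) ⟩
      bil v v + bil v (λ p → x * e p) + x * (bil e v + bil e (λ p → x * e p))
        ≡⟨ cong₂ (λ s t → bil v v + s + x * (bil e v + t)) (bil-*ʳ x v e) (trans (bil-*ʳ x e e) (cong (x *_) (bil-basis j))) ⟩
      bil v v + x * bil v e + x * (bil e v + x * G j j)
        ≡⟨ regroup x (bil v v) (bil v e) (bil e v) (G j j) ⟩
      bil v v + x * (bil e v + bil v e) + x * x * G j j ∎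
      where
        e : Fin d → Z k
        e = basis j
        regroup : ∀ x q s t g → q + x * s + x * (t + x * g) ≡ q + x * (t + s) + x * x * g
        regroup = solve 5 (λ x q s t g → q :+ x :* s :+ x :* (t :+ x :* g) := q :+ x :* (t :+ s) :+ x :* x :* g) refl

    bil-scale : ∀ μ v → bil (λ p → μ * v p) (λ p → μ * v p) ≡ (μ * μ) * bil v v
    bil-scale μ v = trans (bil-*ˡ μ v _) (trans (cong (μ *_) (bil-*ʳ μ v v)) (sym (*-assoc μ μ _)))

  bil-cong : ∀ {d} (G G' : Fin d → Fin d → Z k) (u u' v v' : Fin d → Z k) →
             (∀ p q → G p q ≡ G' p q) → (∀ p → u p ≡ u' p) → (∀ q → v q ≡ v' q) →
             Bilinear.bil G u v ≡ Bilinear.bil G' u' v'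
  bil-cong {d} G G' u u' v v' G≗G' u≗u' v≗v' = sum-cong d λ p → sum-cong d λ q →
    cong₂ _*_ (u≗u' p) (cong₂ _*_ (G≗G' p q) (v≗v' q))

module Mod2 where

  residues₂ : (x : Z 1) → x ≡ zeroZ 1 ⊎ x ≡ oneZ 1
  residues₂ ⟨ zero ⟩       = inj₁ refl
  residues₂ ⟨ suc zero ⟩   = inj₂ refl

  unit₂ : (x : Z 1) → IsUnit x → x ≡ oneZ 1
  unit₂ ⟨ zero ⟩     (_ , ())
  unit₂ ⟨ suc zero ⟩ _ = refl

  one-unit₂ : {x : Z 1} → x ≡ oneZ 1 → IsUnit x
  one-unit₂ refl = oneZ 1 , refl

  0≢1 : zeroZ 1 ≢ oneZ 1
  0≢1 ()

  is-one : (x : Z 1) → Dec (x ≡ oneZ 1)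
  is-one x with residues₂ x
  ... | inj₁ x≡0 = no λ x≡1 → 0≢1 (trans (sym x≡0) x≡1)
  ... | inj₂ x≡1 = yes x≡1

module OddInverse where
  open import Data.Nat.Solver using (module +-*-Solver)
  open +-*-Solver using (solve; con; _:+_; _:*_; _:=_)

  parity : ∀ c → ∃ λ q → c ≡ q ℕ.* 2 ⊎ c ≡ 1 ℕ.+ q ℕ.* 2
  parity 0 = 0 , inj₁ refl
  parity (ℕ.suc c) with parity c
  ... | q , inj₁ c≡2q   = q , inj₂ (cong ℕ.suc c≡2q)
  ... | q , inj₂ c≡2q+1 = ℕ.suc q , inj₁ (cong ℕ.suc c≡2q+1)

  -- An odd number u has an inverse modulo every power of two: if u y = 1 + c 2^t
  -- then either c is even, or u (y + 2^t) = 1 + (c + u) 2^t with c + u even.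
  odd-invertible : ∀ h t → ∃ λ y → ∃ λ c → (1 ℕ.+ h ℕ.* 2) ℕ.* y ≡ 1 ℕ.+ c ℕ.* 2 ℕ.^ t
  odd-invertible h 0 = 1 , h ℕ.* 2 , solve 1 (λ h → (con 1 :+ h :* con 2) :* con 1 := con 1 :+ (h :* con 2) :* con 1) refl h
  odd-invertible h (ℕ.suc t) with odd-invertible h t
  ... | y , c , uy≡ with parity c
  ...   | q , inj₁ refl = y , q , trans uy≡
    (solve 2 (λ q P → con 1 :+ (q :* con 2) :* P := con 1 :+ q :* (con 2 :* P)) refl q (2 ℕ.^ t))
  ...   | q , inj₂ refl = y ℕ.+ 2 ℕ.^ t , q ℕ.+ h ℕ.+ 1 , (begin
      u ℕ.* (y ℕ.+ 2 ℕ.^ t)                    ≡⟨ ℕP.*-distribˡ-+ u y (2 ℕ.^ t) ⟩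
      u ℕ.* y ℕ.+ u ℕ.* 2 ℕ.^ t                ≡⟨ cong (ℕ._+ u ℕ.* 2 ℕ.^ t) uy≡ ⟩
      1 ℕ.+ (1 ℕ.+ q ℕ.* 2) ℕ.* 2 ℕ.^ t ℕ.+ u ℕ.* 2 ℕ.^ t
        ≡⟨ solve 3 (λ h q P → con 1 :+ (con 1 :+ q :* con 2) :* P :+ (con 1 :+ h :* con 2) :* P
                             := con 1 :+ (q :+ h :+ con 1) :* (con 2 :* P)) refl h q (2 ℕ.^ t) ⟩
      1 ℕ.+ (q ℕ.+ h ℕ.+ 1) ℕ.* 2 ℕ.^ ℕ.suc t   ∎)
    where open ≡-Reasoning
          u : ℕ
          u = 1 ℕ.+ h ℕ.* 2

module Reduction (k' : ℕ) where
  k : ℕ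
  k = ℕ.suc k'

  module R  = Residues k
  module R₂ = Residues 1
  open R using (∣_∣; residue-ind; _+_; _*_)
  open OddInverse using (odd-invertible)
  open ≡-Reasoning

  π-fromNat : ∀ x → π (fromNat k x) ≡ fromNat 1 x
  π-fromNat x = trans (cong (fromNat 1) (R.∣fromNat∣ x))
                      (R₂.fromNat-cong {x % 2 ℕ.^ k} {x} (m∣n⇒o%n%m≡o%m 2 (2 ℕ.^ k) x 2∣2^k))
    where 2∣2^k : 2 ∣ 2 ℕ.^ k
          2∣2^k = divides (2 ℕ.^ k') (ℕP.*-comm 2 (2 ℕ.^ k'))

  π-+ : ∀ a b → π (a + b) ≡ π a R₂.+ π b
  π-+ = residue-ind λ x → residue-ind λ y → begin
    π (fromNat k x + fromNat k y)       ≡⟨ cong π (R.fromNat-+ x y) ⟩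
    π (fromNat k (x ℕ.+ y))             ≡⟨ π-fromNat (x ℕ.+ y) ⟩
    fromNat 1 (x ℕ.+ y)                 ≡⟨ R₂.fromNat-+ x y ⟨
    fromNat 1 x R₂.+ fromNat 1 y        ≡⟨ cong₂ R₂._+_ (π-fromNat x) (π-fromNat y) ⟨
    π (fromNat k x) R₂.+ π (fromNat k y) ∎

  π-* : ∀ a b → π (a * b) ≡ π a R₂.* π b
  π-* = residue-ind λ x → residue-ind λ y → begin
    π (fromNat k x * fromNat k y)       ≡⟨ cong π (R.fromNat-* x y) ⟩
    π (fromNat k (x ℕ.* y))             ≡⟨ π-fromNat (x ℕ.* y) ⟩
    fromNat 1 (x ℕ.* y)                 ≡⟨ R₂.fromNat-* x y ⟨
    fromNat 1 x R₂.* fromNat 1 y        ≡⟨ cong₂ R₂._*_ (π-fromNat x) (π-fromNat y) ⟨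
    π (fromNat k x) R₂.* π (fromNat k y) ∎

  π-sum : ∀ d (f : Fin d → Z k) → π (sumZ d f) ≡ sumZ d (π ∘ f)
  π-sum 0         f = π-fromNat 0
  π-sum (ℕ.suc d) f = trans (π-+ (f zero) _) (cong (π (f zero) R₂.+_) (π-sum d (f ∘ suc)))

  π-bil : ∀ {d} (G : Fin d → Fin d → Z k) u v →
          π (R.Bilinear.bil G u v) ≡ R₂.Bilinear.bil (λ p q → π (G p q)) (π ∘ u) (π ∘ v)
  π-bil {d} G u v = trans (π-sum d _) (R₂.sum-cong d λ p → trans (π-sum d _) (R₂.sum-cong d λ q →
    trans (π-* (u p) _) (cong (π (u p) R₂.*_) (π-* (G p q) (v q)))))

  π-neg : ∀ a → π (R.- a) ≡ R₂.- (π a)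
  π-neg a = R₂.inverseˡ-unique (π (R.- a)) (π a)
    (trans (sym (π-+ (R.- a) a)) (trans (cong π (R.-‿inverseˡ a)) (π-fromNat 0)))

  halves : ∀ a → ∣ a ∣ ≡ R₂.∣ π a ∣ ℕ.+ (∣ a ∣ / 2) ℕ.* 2
  halves a = trans (m≡m%n+[m/n]*n ∣ a ∣ 2) (cong (ℕ._+ (∣ a ∣ / 2) ℕ.* 2) (sym (R₂.∣fromNat∣ ∣ a ∣)))

  halves-odd : ∀ a → π a ≡ oneZ 1 → ∣ a ∣ ≡ 1 ℕ.+ (∣ a ∣ / 2) ℕ.* 2
  halves-odd a πa≡1 = trans (halves a) (cong (λ r → R₂.∣ r ∣ ℕ.+ (∣ a ∣ / 2) ℕ.* 2) πa≡1)

  halves-even : ∀ a → π a ≡ zeroZ 1 → ∣ a ∣ ≡ (∣ a ∣ / 2) ℕ.* 2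
  halves-even a πa≡0 = trans (halves a) (cong (λ r → R₂.∣ r ∣ ℕ.+ (∣ a ∣ / 2) ℕ.* 2) πa≡0)

  unit⇒odd : ∀ a → IsUnit a → π a ≡ oneZ 1
  unit⇒odd a (b , ab≡1) = Mod2.unit₂ (π a) (π b , (begin
    π a R₂.* π b   ≡⟨ π-* a b ⟨
    π (a * b)      ≡⟨ cong π ab≡1 ⟩
    π (oneZ k)     ≡⟨ π-fromNat 1 ⟩
    oneZ 1         ∎))

  odd⇒unit : ∀ a → π a ≡ oneZ 1 → IsUnit a
  odd⇒unit a πa≡1 with odd-invertible (∣ a ∣ / 2) k
  ... | y , c , uy≡ = fromNat k y , (begin
    a * fromNat k y                      ≡⟨ cong (_* fromNat k y) (R.fromNat-∣∣ a) ⟨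
    fromNat k ∣ a ∣ * fromNat k y        ≡⟨ R.fromNat-* ∣ a ∣ y ⟩
    fromNat k (∣ a ∣ ℕ.* y)              ≡⟨ cong (λ m → fromNat k (m ℕ.* y)) (halves-odd a πa≡1) ⟩
    fromNat k ((1 ℕ.+ (∣ a ∣ / 2) ℕ.* 2) ℕ.* y) ≡⟨ cong (fromNat k) uy≡ ⟩
    fromNat k (1 ℕ.+ c ℕ.* 2 ℕ.^ k)      ≡⟨ R.fromNat-cong ([m+kn]%n≡m%n 1 c (2 ℕ.^ k)) ⟩
    oneZ k                               ∎)

  double : Fin (2 ℕ.^ k') → Z k
  double h = fromNat k 2 * fromNat k (toℕ h)

  ∣double∣ : ∀ h → ∣ double h ∣ ≡ toℕ h ℕ.* 2
  ∣double∣ h = begin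
    ∣ double h ∣                 ≡⟨ cong ∣_∣ (R.fromNat-* 2 (toℕ h)) ⟩
    ∣ fromNat k (2 ℕ.* toℕ h) ∣  ≡⟨ R.∣fromNat∣ (2 ℕ.* toℕ h) ⟩
    (2 ℕ.* toℕ h) % 2 ℕ.^ k      ≡⟨ m<n⇒m%n≡m (ℕP.*-monoʳ-< 2 (FinP.toℕ<n h)) ⟩
    2 ℕ.* toℕ h                  ≡⟨ ℕP.*-comm 2 (toℕ h) ⟩
    toℕ h ℕ.* 2                  ∎

  double-injective : ∀ h h' → double h ≡ double h' → h ≡ h'
  double-injective h h' e = FinP.toℕ-injective (ℕP.*-cancelʳ-≡ (toℕ h) (toℕ h') 2
    (trans (sym (∣double∣ h)) (trans (cong ∣_∣ e) (∣double∣ h'))))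

  even⇒double : ∀ e → π e ≡ zeroZ 1 → ∃ λ h → e ≡ double h
  even⇒double e πe≡0 = h , R.residue-ext (begin
    ∣ e ∣                         ≡⟨ halves-even e πe≡0 ⟩
    (∣ e ∣ / 2) ℕ.* 2             ≡⟨ cong (ℕ._* 2) (FinP.toℕ-fromℕ< h<) ⟨
    toℕ h ℕ.* 2                   ≡⟨ ∣double∣ h ⟨
    ∣ double h ∣                  ∎)
    where
      h< : ∣ e ∣ / 2 ℕ.< 2 ℕ.^ k'
      h< = m<n*o⇒m/o<n (subst (∣ e ∣ ℕ.<_) (ℕP.*-comm 2 (2 ℕ.^ k')) (FinP.toℕ<n (val e)))
      h : Fin (2 ℕ.^ k')
      h = Fin.fromℕ< h<

  double-even : ∀ c → π (fromNat k 2 * c) ≡ zeroZ 1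
  double-even c = trans (π-* (fromNat k 2) c) (trans (cong (R₂._* π c) (π-fromNat 2)) (R₂.zeroˡ (π c)))

-- The Gram matrix G_{2ν+δ,Δ} takes only the three values 1, 0 and z.  We
-- record its pattern on ℕ-indices with the three values as parameters:
-- Gmat k ν δ z i j is by definition gram (oneZ k) (zeroZ k) z ν δ (toℕ i) (toℕ j),
-- and maps such as π can be pushed through the pattern.
module GramPattern {A : Set} (o e zz : A) (ν δ : ℕ) where

  gram : ℕ → ℕ → A
  gram i j =
    if (i <ᵇ ν) ∧ (j ≡ᵇ (i ℕ.+ ν)) then o
    else if (i <ᵇ 2 ℕ.* ν) then e
    else if (j <ᵇ 2 ℕ.* ν) then e
    else if (δ ≡ᵇ 1) then (if i ≡ᵇ j then o else e)
    else if (i ≡ᵇ j) then zz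
    else if (j ≡ᵇ ℕ.suc i) then o
    else e

  block : ℕ → ℕ → A
  block r s =
    if (δ ≡ᵇ 1) then (if r ≡ᵇ s then o else e)
    else if (r ≡ᵇ s) then zz
    else if (s ≡ᵇ ℕ.suc r) then o
    else e

  private
    <ᵇ-true : ∀ {m n} → m ℕ.< n → (m <ᵇ n) ≡ true
    <ᵇ-true m<n = Equivalence.to T-≡ (ℕP.<⇒<ᵇ m<n)

    <ᵇ-false : ∀ {m n} → n ℕ.≤ m → (m <ᵇ n) ≡ false
    <ᵇ-false {m} {n} n≤m = ¬-not λ m<ᵇn → ℕP.<⇒≱ (ℕP.<ᵇ⇒< m n (Equivalence.from T-≡ m<ᵇn)) n≤m

    ≡ᵇ-true : ∀ {m n} → m ≡ n → (m ≡ᵇ n) ≡ true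
    ≡ᵇ-true {m} {n} m≡n = Equivalence.to T-≡ (ℕP.≡⇒≡ᵇ m n m≡n)

    ≡ᵇ-false : ∀ {m n} → m ≢ n → (m ≡ᵇ n) ≡ false
    ≡ᵇ-false {m} {n} m≢n = ¬-not λ m≡ᵇn → m≢n (ℕP.≡ᵇ⇒≡ m n (Equivalence.from T-≡ m≡ᵇn))

    ≡ᵇ-+ : ∀ m r s → (m ℕ.+ r ≡ᵇ m ℕ.+ s) ≡ (r ≡ᵇ s)
    ≡ᵇ-+ 0         r s = refl
    ≡ᵇ-+ (ℕ.suc m) r s = ≡ᵇ-+ m r s

    2ν≤→ν≤ : ∀ {i} → 2 ℕ.* ν ℕ.≤ i → ν ℕ.≤ i
    2ν≤→ν≤ = ℕP.≤-trans (ℕP.m≤m+n ν _)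

  gram-row-zero : ∀ i j → ν ℕ.≤ i → i ℕ.< 2 ℕ.* ν → gram i j ≡ e
  gram-row-zero i j ν≤i i<2ν rewrite <ᵇ-false ν≤i | <ᵇ-true i<2ν = refl

  gram-col-zero : ∀ i j → j ℕ.< ν → gram i j ≡ e
  gram-col-zero i j j<ν
    rewrite ≡ᵇ-false {j} {i ℕ.+ ν} (ℕP.<⇒≢ (ℕP.≤-trans j<ν (ℕP.m≤n+m ν i))) | ∧-zeroʳ (i <ᵇ ν)
          | <ᵇ-true {j} {2 ℕ.* ν} (ℕP.≤-trans j<ν (ℕP.m≤m+n ν _))
    with i <ᵇ 2 ℕ.* ν
  ... | true  = refl
  ... | false = refl

  gram-pair : ∀ i j → i ℕ.< ν → j ≡ i ℕ.+ ν → gram i j ≡ o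
  gram-pair i j i<ν j≡i+ν rewrite <ᵇ-true i<ν | ≡ᵇ-true j≡i+ν = refl

  gram-pair-other : ∀ i j → i ℕ.< ν → j ≢ i ℕ.+ ν → gram i j ≡ e
  gram-pair-other i j i<ν j≢i+ν
    rewrite <ᵇ-true i<ν | ≡ᵇ-false j≢i+ν | <ᵇ-true {i} {2 ℕ.* ν} (ℕP.≤-trans i<ν (ℕP.m≤m+n ν _)) = refl

  gram-block-row : ∀ i j → 2 ℕ.* ν ℕ.≤ i → j ℕ.< 2 ℕ.* ν → gram i j ≡ e
  gram-block-row i j 2ν≤i j<2ν rewrite <ᵇ-false {i} {ν} (2ν≤→ν≤ 2ν≤i) | <ᵇ-false 2ν≤i | <ᵇ-true j<2ν = refl

  gram-block : ∀ r s → gram (2 ℕ.* ν ℕ.+ r) (2 ℕ.* ν ℕ.+ s) ≡ block r s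
  gram-block r s
    rewrite <ᵇ-false {2 ℕ.* ν ℕ.+ r} {ν} (2ν≤→ν≤ (ℕP.m≤m+n _ r)) | <ᵇ-false {2 ℕ.* ν ℕ.+ r} (ℕP.m≤m+n _ r)
          | <ᵇ-false {2 ℕ.* ν ℕ.+ s} (ℕP.m≤m+n _ s) | ≡ᵇ-+ (2 ℕ.* ν) r s
          | sym (ℕP.+-suc (2 ℕ.* ν) r) | ≡ᵇ-+ (2 ℕ.* ν) s (ℕ.suc r) = refl

gram-map : {A B : Set} (f : A → B) (o e zz : A) (ν δ i j : ℕ) →
           f (GramPattern.gram o e zz ν δ i j) ≡ GramPattern.gram (f o) (f e) (f zz) ν δ i j
gram-map f o e zz ν δ i j with (i <ᵇ ν) ∧ (j ≡ᵇ (i ℕ.+ ν))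
... | true = refl
... | false with i <ᵇ 2 ℕ.* ν
... | true = refl
... | false with j <ᵇ 2 ℕ.* ν
... | true = refl
... | false with δ ≡ᵇ 1
... | true = if-float f (i ≡ᵇ j)
... | false with i ≡ᵇ j
... | true = refl
... | false = if-float f (j ≡ᵇ ℕ.suc i)

module Form (k ν δ : ℕ) (z : Z k) where
  open Residues k
  open GramPattern (oneZ k) (zeroZ k) z ν δ
  open ≡-Reasoning

  d : ℕ
  d = 2 ℕ.* ν ℕ.+ δ

  G : Fin d → Fin d → Z k
  G = Gmat k ν δ z

  open Bilinear G public

  2ν≤d : 2 ℕ.* ν ℕ.≤ d
  2ν≤d = ℕP.m≤m+n _ δ

  +ν<2ν : ∀ {m} → m ℕ.< ν → m ℕ.+ ν ℕ.< 2 ℕ.* ν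
  +ν<2ν {m} m<ν = subst (m ℕ.+ ν ℕ.<_) (cong (ν ℕ.+_) (sym (ℕP.+-identityʳ ν))) (ℕP.+-monoˡ-< ν m<ν)

  record Partner (i : Fin d) : Set where
    field
      j     : Fin d
      i≢j   : i ≢ j
      Gjj≡0 : G j j ≡ 0#
      polar : ∀ v → bil (basis j) v + bil v (basis j) ≡ v i

  column-single : ∀ i j p → toℕ i ℕ.< ν → toℕ j ≡ toℕ i ℕ.+ ν → p ≢ i → G p j ≡ 0#
  column-single i j p i<ν j≡i+ν p≢i with toℕ p ℕ.<? ν | toℕ p ℕ.<? 2 ℕ.* ν
  ... | yes p<ν | _ = gram-pair-other (toℕ p) (toℕ j) p<ν
                        (λ j≡p+ν → p≢i (FinP.toℕ-injective (ℕP.+-cancelʳ-≡ _ _ _ (trans (sym j≡p+ν) j≡i+ν))))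
  ... | no p≮ν | yes p<2ν = gram-row-zero (toℕ p) (toℕ j) (ℕP.≮⇒≥ p≮ν) p<2ν
  ... | no _   | no p≮2ν  = gram-block-row (toℕ p) (toℕ j) (ℕP.≮⇒≥ p≮2ν)
                              (subst (ℕ._< 2 ℕ.* ν) (sym j≡i+ν) (+ν<2ν i<ν))

  -- for i < ν the partner is j = i + ν: row j vanishes and column j is e_i
  partner-low : ∀ i → toℕ i ℕ.< ν → Partner i
  partner-low i i<ν = record { j = j ; i≢j = i≢j ; Gjj≡0 = gram-row-zero (toℕ j) (toℕ j) ν≤j j<2ν ; polar = polar }
    where
      j : Fin d
      j = Fin.fromℕ< (ℕP.≤-trans (+ν<2ν i<ν) 2ν≤d)
      j≡i+ν : toℕ j ≡ toℕ i ℕ.+ ν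
      j≡i+ν = FinP.toℕ-fromℕ< _
      ν≤j : ν ℕ.≤ toℕ j
      ν≤j = subst (ν ℕ.≤_) (sym j≡i+ν) (ℕP.m≤n+m ν (toℕ i))
      j<2ν : toℕ j ℕ.< 2 ℕ.* ν
      j<2ν = subst (ℕ._< 2 ℕ.* ν) (sym j≡i+ν) (+ν<2ν i<ν)
      i≢j : i ≢ j
      i≢j i≡j = ℕP.<⇒≱ i<ν (subst (ν ℕ.≤_) (cong toℕ (sym i≡j)) ν≤j)
      row-j≡0 : ∀ v → bil (basis j) v ≡ 0#
      row-j≡0 v = trans (bil-basisˡ j v) (sum-zero d _ λ q →
        trans (cong (_* v q) (gram-row-zero (toℕ j) (toℕ q) ν≤j j<2ν)) (zeroˡ (v q)))
      polar : ∀ v → bil (basis j) v + bil v (basis j) ≡ v i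
      polar v = begin
        bil (basis j) v + bil v (basis j)   ≡⟨ cong₂ _+_ (row-j≡0 v) (bil-basisʳ j v) ⟩
        0# + sumZ d (λ p → v p * G p j)     ≡⟨ +-identityˡ _ ⟩
        sumZ d (λ p → v p * G p j)          ≡⟨ sum-single d _ i (λ p p≢i →
                                                 trans (cong (v p *_) (column-single i j p i<ν j≡i+ν p≢i)) (zeroʳ (v p))) ⟩
        v i * G i j                         ≡⟨ cong (v i *_) (gram-pair (toℕ i) (toℕ j) i<ν j≡i+ν) ⟩
        v i * 1#                            ≡⟨ *-identityʳ (v i) ⟩
        v i                                 ∎

  -- for ν ≤ i < 2ν the partner is j = i - ν: column j vanishes and row j is e_i
  partner-high : ∀ i → ν ℕ.≤ toℕ i → toℕ i ℕ.< 2 ℕ.* ν → Partner i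
  partner-high i ν≤i i<2ν = record { j = j ; i≢j = i≢j ; Gjj≡0 = gram-col-zero (toℕ j) (toℕ j) j<ν ; polar = polar }
    where
      j : Fin d
      j = Fin.fromℕ< (ℕP.≤-trans (ℕ.s≤s (ℕP.m∸n≤m (toℕ i) ν)) (FinP.toℕ<n i))
      i≡j+ν : toℕ i ≡ toℕ j ℕ.+ ν
      i≡j+ν = sym (trans (cong (ℕ._+ ν) (FinP.toℕ-fromℕ< _)) (ℕP.m∸n+n≡m ν≤i))
      j<ν : toℕ j ℕ.< ν
      j<ν = ℕP.+-cancelʳ-< ν (toℕ j) ν (subst (ℕ._< ν ℕ.+ ν) i≡j+ν
              (subst (toℕ i ℕ.<_) (cong (ν ℕ.+_) (ℕP.+-identityʳ ν)) i<2ν))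
      i≢j : i ≢ j
      i≢j i≡j = ℕP.<⇒≱ j<ν (subst (ν ℕ.≤_) (cong toℕ i≡j) ν≤i)
      column-j≡0 : ∀ v → bil v (basis j) ≡ 0#
      column-j≡0 v = trans (bil-basisʳ j v) (sum-zero d _ λ p →
        trans (cong (v p *_) (gram-col-zero (toℕ p) (toℕ j) j<ν)) (zeroʳ (v p)))
      row-single : ∀ q → q ≢ i → G j q ≡ 0#
      row-single q q≢i = gram-pair-other (toℕ j) (toℕ q) j<ν
        (λ q≡j+ν → q≢i (FinP.toℕ-injective (trans q≡j+ν (sym i≡j+ν))))
      polar : ∀ v → bil (basis j) v + bil v (basis j) ≡ v i
      polar v = begin
        bil (basis j) v + bil v (basis j)   ≡⟨ cong₂ _+_ (bil-basisˡ j v) (column-j≡0 v) ⟩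
        sumZ d (λ q → G j q * v q) + 0#     ≡⟨ +-identityʳ _ ⟩
        sumZ d (λ q → G j q * v q)          ≡⟨ sum-single d _ i (λ q q≢i →
                                                 trans (cong (_* v q) (row-single q q≢i)) (zeroˡ (v q))) ⟩
        G j i * v i                         ≡⟨ cong (_* v i) (gram-pair (toℕ j) (toℕ i) j<ν i≡j+ν) ⟩
        1# * v i                            ≡⟨ *-identityˡ (v i) ⟩
        v i                                 ∎

  partner : ∀ i → toℕ i ℕ.< 2 ℕ.* ν → Partner i
  partner i i<2ν with toℕ i ℕ.<? ν
  ... | yes i<ν = partner-low i i<ν
  ... | no  i≮ν = partner-high i (ℕP.≮⇒≥ i≮ν) i<2ν

  line : ∀ {i} (P : Partner i) v x → let open Partner P in
         bil (λ p → v p + x * basis j p) (λ p → v p + x * basis j p) ≡ bil v v + x * v i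
  line {i} P v x = begin
    bil (λ p → v p + x * basis j p) (λ p → v p + x * basis j p)
      ≡⟨ bil-line v j x ⟩
    bil v v + x * (bil (basis j) v + bil v (basis j)) + x * x * G j j
      ≡⟨ cong₂ (λ s g → bil v v + x * s + x * x * g) (polar v) Gjj≡0 ⟩
    bil v v + x * v i + x * x * 0#
      ≡⟨ trans (cong (bil v v + x * v i +_) (zeroʳ (x * x))) (+-identityʳ _) ⟩
    bil v v + x * v i ∎
    where open Partner P

  Δ : Fin δ → Fin δ → Z k
  Δ r s = block (toℕ r) (toℕ s)

  G-block : ∀ r s → G (2 ℕ.* ν ↑ʳ r) (2 ℕ.* ν ↑ʳ s) ≡ Δ r s
  G-block r s rewrite FinP.toℕ-↑ʳ (2 ℕ.* ν) r | FinP.toℕ-↑ʳ (2 ℕ.* ν) s = gram-block (toℕ r) (toℕ s)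

  block-form : ∀ v → (∀ p → v (p ↑ˡ δ) ≡ 0#) →
               bil v v ≡ Bilinear.bil Δ (λ r → v (2 ℕ.* ν ↑ʳ r)) (λ r → v (2 ℕ.* ν ↑ʳ r))
  block-form v v≗0 = begin
    sumZ d row
      ≡⟨ sum-split (2 ℕ.* ν) δ row ⟩
    sumZ (2 ℕ.* ν) (λ p → row (p ↑ˡ δ)) + sumZ δ (λ r → row (2 ℕ.* ν ↑ʳ r))
      ≡⟨ cong₂ _+_ (sum-zero _ _ λ p → sum-zero d _ λ q → trans (cong (_* (G (p ↑ˡ δ) q * v q)) (v≗0 p)) (zeroˡ _))
                   (sum-cong δ λ r → block-row (2 ℕ.* ν ↑ʳ r) r (G-block r)) ⟩
    0# + Bilinear.bil Δ w w
      ≡⟨ +-identityˡ _ ⟩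
    Bilinear.bil Δ w w ∎
    where
      w : Fin δ → Z k
      w r = v (2 ℕ.* ν ↑ʳ r)
      row : Fin d → Z k
      row p = sumZ d (λ q → v p * (G p q * v q))
      block-row : ∀ p r → (∀ s → G p (2 ℕ.* ν ↑ʳ s) ≡ Δ r s) → row p ≡ sumZ δ (λ s → v p * (Δ r s * w s))
      block-row p r Gp≡Δ = begin
        row p
          ≡⟨ sum-split (2 ℕ.* ν) δ _ ⟩
        sumZ (2 ℕ.* ν) (λ q → v p * (G p (q ↑ˡ δ) * v (q ↑ˡ δ))) + sumZ δ (λ s → v p * (G p (2 ℕ.* ν ↑ʳ s) * w s))
          ≡⟨ cong₂ _+_ (sum-zero _ _ λ q → trans (cong (λ c → v p * (G p (q ↑ˡ δ) * c)) (v≗0 q))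
                                                 (trans (cong (v p *_) (zeroʳ (G p (q ↑ˡ δ)))) (zeroʳ (v p))))
                       (sum-cong δ λ s → cong (λ g → v p * (g * w s)) (Gp≡Δ s)) ⟩
        0# + sumZ δ (λ s → v p * (Δ r s * w s))
          ≡⟨ +-identityˡ _ ⟩
        sumZ δ (λ s → v p * (Δ r s * w s)) ∎

module Anisotropy where
  open Mod2
  open import Data.Vec.Functional using ([]; _∷_)

  Δ₂ : ∀ ν δ → Fin δ → Fin δ → Z 1
  Δ₂ ν δ = Form.Δ 1 ν δ (oneZ 1)

  one-dim : ∀ ν x → Residues.Bilinear.bil 1 (Δ₂ ν 1) (x ∷ []) (x ∷ []) ≡ zeroZ 1 → x ≡ zeroZ 1
  one-dim ν ⟨ zero ⟩     _ = refl
  one-dim ν ⟨ suc zero ⟩ ()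

  two-dim : ∀ ν x y → Residues.Bilinear.bil 1 (Δ₂ ν 2) (x ∷ y ∷ []) (x ∷ y ∷ []) ≡ zeroZ 1 →
            x ≡ zeroZ 1 × y ≡ zeroZ 1
  two-dim ν ⟨ zero ⟩     ⟨ zero ⟩     _ = refl , refl
  two-dim ν ⟨ zero ⟩     ⟨ suc zero ⟩ ()
  two-dim ν ⟨ suc zero ⟩ ⟨ zero ⟩     ()
  two-dim ν ⟨ suc zero ⟩ ⟨ suc zero ⟩ ()

  anisotropic : ∀ ν δ → δ ℕ.≤ 2 → (w : Fin δ → Z 1) →
                Residues.Bilinear.bil 1 (Δ₂ ν δ) w w ≡ zeroZ 1 → ∀ r → w r ≡ zeroZ 1
  anisotropic ν 0 _ w Q≡0 ()
  anisotropic ν 1 _ w Q≡0 zero       = one-dim ν (w zero) Q≡0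
  anisotropic ν 2 _ w Q≡0 zero       = proj₁ (two-dim ν (w zero) (w (suc zero)) Q≡0)
  anisotropic ν 2 _ w Q≡0 (suc zero) = proj₂ (two-dim ν (w zero) (w (suc zero)) Q≡0)
  anisotropic ν (ℕ.suc (ℕ.suc (ℕ.suc δ))) (ℕ.s≤s (ℕ.s≤s ())) w Q≡0 r

  -- every vertex of O₂ has a nonzero hyperbolic coordinate, since a vector
  -- supported on the block is anisotropic
  hyperbolic-coordinate : ∀ ν δ → δ ℕ.≤ 2 → (v : Tup 1 (2 ℕ.* ν ℕ.+ δ)) → IsVertex 1 ν δ (oneZ 1) v →
                          ∃ λ (p : Fin (2 ℕ.* ν)) → v (p ↑ˡ δ) ≡ oneZ 1
  hyperbolic-coordinate ν δ δ≤2 v ((i₀ , vi₀-unit) , Q≡0) with FinP.any? (λ p → is-one (v (p ↑ˡ δ)))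
  ... | yes found = found
  ... | no  none  = ⊥-elim (0≢1 (trans (sym (v≗0 i₀)) (unit₂ (v i₀) vi₀-unit)))
    where
      head≗0 : ∀ p → v (p ↑ˡ δ) ≡ zeroZ 1
      head≗0 p with residues₂ (v (p ↑ˡ δ))
      ... | inj₁ vp≡0 = vp≡0
      ... | inj₂ vp≡1 = ⊥-elim (none (p , vp≡1))
      tail≗0 : ∀ r → v (2 ℕ.* ν ↑ʳ r) ≡ zeroZ 1
      tail≗0 = anisotropic ν δ δ≤2 _ (trans (sym (Form.block-form 1 ν δ (oneZ 1) v head≗0)) Q≡0)
      v≗0 : ∀ i → v i ≡ zeroZ 1
      v≗0 i = subst (λ i → v i ≡ zeroZ 1) (FinP.join-splitAt (2 ℕ.* ν) δ i) (on-parts (Fin.splitAt (2 ℕ.* ν) i))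
        where on-parts : ∀ s → v (Fin.join (2 ℕ.* ν) δ s) ≡ zeroZ 1
              on-parts (inj₁ p) = head≗0 p
              on-parts (inj₂ r) = tail≗0 r

module Reduced (n' ν δ : ℕ) (z : Z (ℕ.suc n')) where
  open Reduction n'
  open Mod2

  d : ℕ
  d = 2 ℕ.* ν ℕ.+ δ

  G : Fin d → Fin d → Z k
  G = Gmat k ν δ z

  G₂ : Fin d → Fin d → Z 1
  G₂ = Gmat 1 ν δ (π z)

  π-G : ∀ p q → π (G p q) ≡ G₂ p q
  π-G p q = trans (gram-map π (oneZ k) (zeroZ k) z ν δ (toℕ p) (toℕ q))
                  (cong₂ (λ o e → GramPattern.gram o e (π z) ν δ (toℕ p) (toℕ q)) (π-fromNat 1) (π-fromNat 0))

  π-Qform : ∀ a → π (Qform k ν δ z a) ≡ Qform 1 ν δ (π z) (πv a)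
  π-Qform a = trans (π-bil {d} G a a)
    (R₂.bil-cong (λ p q → π (G p q)) G₂ (πv a) (πv a) (πv a) (πv a) π-G (λ _ → refl) (λ _ → refl))

  π-Bform : ∀ a b → π (Bform k ν δ z a b) ≡ Bform 1 ν δ (π z) (πv a) (πv b)
  π-Bform a b = trans (π-bil {d} (λ p q → G p q R.+ G q p) a b)
    (R₂.bil-cong (λ p q → π (G p q R.+ G q p)) (λ p q → G₂ p q R₂.+ G₂ q p) (πv a) (πv a) (πv b) (πv b)
                 (λ p q → trans (π-+ (G p q) (G q p)) (cong₂ R₂._+_ (π-G p q) (π-G q p))) (λ _ → refl) (λ _ → refl))

  vertex-reduces : ∀ a → IsVertex k ν δ z a → IsVertex 1 ν δ (π z) (πv a)
  vertex-reduces a ((i , ai-unit) , Q≡0) =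
    (i , one-unit₂ (unit⇒odd (a i) ai-unit)) , trans (sym (π-Qform a)) (trans (cong π Q≡0) (π-fromNat 0))

  -- a vertex has a unit among its hyperbolic coordinates, since its
  -- reduction does (π z = 1 as z is a unit)
  hyperbolic-unit : δ ℕ.≤ 2 → IsUnit z → ∀ a → IsVertex k ν δ z a →
                    ∃ λ (i : Fin d) → toℕ i ℕ.< 2 ℕ.* ν × IsUnit (a i)
  hyperbolic-unit δ≤2 z-unit a a-vertex = lift-coordinate (Anisotropy.hyperbolic-coordinate ν δ δ≤2 (πv a) reduced)
    where
      reduced : IsVertex 1 ν δ (oneZ 1) (πv a)
      reduced = subst (λ z₂ → IsVertex 1 ν δ z₂ (πv a)) (unit⇒odd z z-unit) (vertex-reduces a a-vertex)
      lift-coordinate : (∃ λ (p : Fin (2 ℕ.* ν)) → π (a (p ↑ˡ δ)) ≡ oneZ 1) →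
                        ∃ λ (i : Fin d) → toℕ i ℕ.< 2 ℕ.* ν × IsUnit (a i)
      lift-coordinate (p , πa≡1) =
        p ↑ˡ δ , subst (ℕ._< 2 ℕ.* ν) (sym (FinP.toℕ-↑ˡ p δ)) (FinP.toℕ<n p) , odd⇒unit (a (p ↑ˡ δ)) πa≡1

  adjacency-mod-2 : ∀ a b → IsVertex k ν δ z a → IsVertex k ν δ z b →
                    AdjVertices k ν δ z a b ⇔ AdjVertices 1 ν δ (π z) (πv a) (πv b)
  adjacency-mod-2 a b a-vertex b-vertex = mk⇔
    (λ (_ , _ , B-unit) → vertex-reduces a a-vertex , vertex-reduces b b-vertex ,
                          one-unit₂ (trans (sym (π-Bform a b)) (unit⇒odd (Bform k ν δ z a b) B-unit)))
    (λ (_ , _ , B₂-unit) → a-vertex , b-vertex , odd⇒unit (Bform k ν δ z a b) (trans (π-Bform a b) (unit₂ _ B₂-unit)))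

  π-even-shift : ∀ (a m : Tup k d) → (∀ i → IsEven (m i)) → ∀ p → π (addV a m p) ≡ π (a p)
  π-even-shift a m m-even p = begin
    π (a p R.+ m p)          ≡⟨ π-+ (a p) (m p) ⟩
    π (a p) R₂.+ π (m p)     ≡⟨ cong (π (a p) R₂.+_) (trans (cong π (proj₂ (m-even p))) (double-even _)) ⟩
    π (a p) R₂.+ zeroZ 1     ≡⟨ R₂.+-identityʳ (π (a p)) ⟩
    π (a p)                  ∎
    where open ≡-Reasoning

  adjacency-lifts : ∀ a b → AdjVertices 1 ν δ (π z) (πv a) (πv b) →
                    (m₁ m₂ : Tup k d) → (∀ i → IsEven (m₁ i)) → (∀ i → IsEven (m₂ i)) →
                    Qform k ν δ z (addV a m₁) ≡ zeroZ k → Qform k ν δ z (addV b m₂) ≡ zeroZ k →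
                    AdjVertices k ν δ z (addV a m₁) (addV b m₂)
  adjacency-lifts a b (((ia , πa-unit) , _) , ((ib , πb-unit) , _) , B₂-unit) m₁ m₂ m₁-even m₂-even Q₁≡0 Q₂≡0 =
    ((ia , odd⇒unit (addV a m₁ ia) (trans (shift₁ ia) (unit₂ _ πa-unit))) , Q₁≡0) ,
    ((ib , odd⇒unit (addV b m₂ ib) (trans (shift₂ ib) (unit₂ _ πb-unit))) , Q₂≡0) ,
    odd⇒unit (Bform k ν δ z (addV a m₁) (addV b m₂)) (trans (π-Bform (addV a m₁) (addV b m₂))
             (trans (R₂.bil-cong G₂+G₂ᵗ G₂+G₂ᵗ _ (πv a) _ (πv b) (λ _ _ → refl) shift₁ shift₂) (unit₂ _ B₂-unit)))
    where
      G₂+G₂ᵗ : Fin d → Fin d → Z 1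
      G₂+G₂ᵗ p q = G₂ p q R₂.+ G₂ q p
      shift₁ : ∀ p → π (addV a m₁ p) ≡ π (a p)
      shift₁ = π-even-shift a m₁ m₁-even
      shift₂ : ∀ p → π (addV b m₂ p) ≡ π (b p)
      shift₂ = π-even-shift b m₂ m₂-even

record Complement {d : ℕ} (i j : Fin d) : Set where
  field
    embed           : Fin (d ∸ 2) → Fin d
    embed-injective : ∀ q q' → embed q ≡ embed q' → q ≡ q'
    embed≢i         : ∀ q → embed q ≢ i
    embed≢j         : ∀ q → embed q ≢ j
    preimage        : ∀ p → p ≢ i → p ≢ j → Fin (d ∸ 2)
    embed-preimage  : ∀ p p≢i p≢j → embed (preimage p p≢i p≢j) ≡ p

  preimage-embed : ∀ q q≢i q≢j → preimage (embed q) q≢i q≢j ≡ q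
  preimage-embed q q≢i q≢j = embed-injective _ q (embed-preimage (embed q) q≢i q≢j)

  preimage-irrelevant : ∀ p p≢i p≢j p≢i' p≢j' → preimage p p≢i p≢j ≡ preimage p p≢i' p≢j'
  preimage-irrelevant p p≢i p≢j p≢i' p≢j' =
    embed-injective _ _ (trans (embed-preimage p p≢i p≢j) (sym (embed-preimage p p≢i' p≢j')))

complement : ∀ {d} (i j : Fin d) → i ≢ j → Complement i j
complement {ℕ.suc 0} zero zero i≢j = ⊥-elim (i≢j refl)
complement {ℕ.suc (ℕ.suc d)} i j i≢j = record
  { embed           = λ q → punchIn i (punchIn j' q)
  ; embed-injective = λ q q' e → FinP.punchIn-injective j' q q' (FinP.punchIn-injective i _ _ e)
  ; embed≢i         = λ q → FinP.punchInᵢ≢i i _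
  ; embed≢j         = λ q e → FinP.punchInᵢ≢i j' q (FinP.punchIn-injective i _ _ (trans e (sym i↑j'≡j)))
  ; preimage        = λ p p≢i p≢j → punchOut (j'≢ p p≢i p≢j)
  ; embed-preimage  = λ p p≢i p≢j → trans (cong (punchIn i) (FinP.punchIn-punchOut (j'≢ p p≢i p≢j)))
                                          (FinP.punchIn-punchOut (p≢i ∘ sym))
  }
  where
    j' : Fin (ℕ.suc d)
    j' = punchOut i≢j
    i↑j'≡j : punchIn i j' ≡ j
    i↑j'≡j = FinP.punchIn-punchOut i≢j
    j'≢ : ∀ p (p≢i : p ≢ i) → p ≢ j → j' ≢ punchOut (p≢i ∘ sym)
    j'≢ p p≢i p≢j e = p≢j (trans (sym (FinP.punchIn-punchOut (p≢i ∘ sym))) (trans (cong (punchIn i) (sym e)) i↑j'≡j))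

module Digits (h m : ℕ) where
  private
    2^h^m : (2 ℕ.^ h) ℕ.^ m ≡ 2 ℕ.^ (h ℕ.* m)
    2^h^m = ℕP.^-*-assoc 2 h m

    funToFin-cong : ∀ {m n} (f g : Fin m → Fin n) → (∀ q → f q ≡ g q) → Fin.funToFin f ≡ Fin.funToFin g
    funToFin-cong {0}       f g f≗g = refl
    funToFin-cong {ℕ.suc m} f g f≗g = cong₂ Fin.combine (f≗g zero) (funToFin-cong (f ∘ suc) (g ∘ suc) (f≗g ∘ suc))

  decode : Fin (2 ℕ.^ (h ℕ.* m)) → Fin m → Fin (2 ℕ.^ h)
  decode x = Fin.finToFun (Fin.cast (sym 2^h^m) x)

  encode : (Fin m → Fin (2 ℕ.^ h)) → Fin (2 ℕ.^ (h ℕ.* m))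
  encode t = Fin.cast 2^h^m (Fin.funToFin t)

  decode-encode : ∀ t q → decode (encode t) q ≡ t q
  decode-encode t q = trans (cong (λ y → Fin.finToFun y q) (FinP.cast-involutive (sym 2^h^m) 2^h^m _))
                            (FinP.finToFun-funToFin t q)

  decode-injective : ∀ x y → (∀ q → decode x q ≡ decode y q) → x ≡ y
  decode-injective x y dx≗dy = begin
    x                                               ≡⟨ FinP.cast-involutive 2^h^m (sym 2^h^m) x ⟨
    Fin.cast 2^h^m (Fin.cast (sym 2^h^m) x)         ≡⟨ cong (Fin.cast 2^h^m) (FinP.funToFin-finToFin {m} {2 ℕ.^ h} _) ⟨
    Fin.cast 2^h^m (Fin.funToFin (decode x))        ≡⟨ cong (Fin.cast 2^h^m) (funToFin-cong _ _ dx≗dy) ⟩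
    Fin.cast 2^h^m (Fin.funToFin (decode y))        ≡⟨ cong (Fin.cast 2^h^m) (FinP.funToFin-finToFin {m} {2 ℕ.^ h} _) ⟩
    Fin.cast 2^h^m (Fin.cast (sym 2^h^m) y)         ≡⟨ FinP.cast-involutive 2^h^m (sym 2^h^m) y ⟩
    y                                               ∎
    where open ≡-Reasoning

-- Completion along the partner of a hyperbolic coordinate i: given the
-- other coordinates of v, with v_i = u a unit, the j-th coordinate is
-- uniquely determined by Q(v) = 0, since Q(v) = Q(v with v_j = 0) + v_j u.
module Completion (n' ν δ : ℕ) (z : Z (ℕ.suc n')) (i : Fin (2 ℕ.* ν ℕ.+ δ)) (i<2ν : toℕ i ℕ.< 2 ℕ.* ν)
                  (u w : Z (ℕ.suc n')) (uw≡1 : mulZ u w ≡ oneZ (ℕ.suc n')) where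
  open Reduction n'
  open R
  open Form k ν δ z
  open Reduced n' ν δ z using (G₂; π-Qform)
  open Partner (partner i i<2ν) public
  open ≡-Reasoning

  Vec : Set
  Vec = Fin d → Z k

  clear : Vec → Vec
  clear v = updateAt v j (λ _ → 0#)

  clear-j : ∀ v → clear v j ≡ 0#
  clear-j v = VecP.updateAt-updates j v

  clear-off : ∀ v p → p ≢ j → clear v p ≡ v p
  clear-off v p p≢j = VecP.updateAt-minimal p j v p≢j

  decompose : ∀ v p → v p ≡ clear v p + v j * basis j p
  decompose v p = by-cases (p Fin.≟ j)
    where
      by-cases : Dec (p ≡ j) → v p ≡ clear v p + v j * basis j p
      by-cases (yes refl) = sym (begin
        clear v j + v j * basis j j ≡⟨ cong₂ (λ c e → c + v j * e) (clear-j v) (basis-same j) ⟩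
        0# + v j * 1#               ≡⟨ trans (+-identityˡ _) (*-identityʳ (v j)) ⟩
        v j                         ∎)
      by-cases (no p≢j) = sym (begin
        clear v p + v j * basis j p ≡⟨ cong₂ (λ c e → c + v j * e) (clear-off v p p≢j) (basis-other j p p≢j) ⟩
        v p + v j * 0#              ≡⟨ trans (cong (v p +_) (zeroʳ (v j))) (+-identityʳ (v p)) ⟩
        v p                         ∎)

  forced : Vec → Z k
  forced v = (- bil (clear v) (clear v)) * w

  complete : Vec → Vec
  complete v p = clear v p + forced v * basis j p

  complete-off : ∀ v p → p ≢ j → complete v p ≡ v p
  complete-off v p p≢j = begin
    clear v p + forced v * basis j p ≡⟨ cong₂ (λ c e → c + forced v * e) (clear-off v p p≢j) (basis-other j p p≢j) ⟩
    v p + forced v * 0#              ≡⟨ trans (cong (v p +_) (zeroʳ (forced v))) (+-identityʳ (v p)) ⟩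
    v p                              ∎

  Q-line : ∀ v x → v i ≡ u → bil (λ p → clear v p + x * basis j p) (λ p → clear v p + x * basis j p) ≡
                             bil (clear v) (clear v) + x * u
  Q-line v x vi≡u = trans (line (partner i i<2ν) (clear v) x)
    (cong (λ c → bil (clear v) (clear v) + x * c) (trans (clear-off v i i≢j) vi≡u))

  complete-isotropic : ∀ v → v i ≡ u → bil (complete v) (complete v) ≡ 0#
  complete-isotropic v vi≡u =
    trans (Q-line v (forced v) vi≡u) (linear-root (bil (clear v) (clear v)) u w uw≡1)

  complete-isotropic-fixed : ∀ v → v i ≡ u → bil v v ≡ 0# → complete v ≗ v
  complete-isotropic-fixed v vi≡u Qv≡0 p = begin
    clear v p + forced v * basis j p   ≡⟨ cong (λ x → clear v p + x * basis j p) (sym vj≡forced) ⟩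
    clear v p + v j * basis j p        ≡⟨ decompose v p ⟨
    v p                                ∎
    where
      vj≡forced : v j ≡ forced v
      vj≡forced = linear-unique _ (v j) u w uw≡1 (begin
        bil (clear v) (clear v) + v j * u ≡⟨ Q-line v (v j) vi≡u ⟨
        bil (λ p → clear v p + v j * basis j p) (λ p → clear v p + v j * basis j p)
          ≡⟨ bil-cong G G _ v _ v (λ _ _ → refl) (sym ∘ decompose v) (sym ∘ decompose v) ⟩
        bil v v                           ≡⟨ Qv≡0 ⟩
        0#                                ∎)

  complete-cong : ∀ v v' → (∀ p → p ≢ j → v p ≡ v' p) → complete v ≗ complete v'
  complete-cong v v' v≗v' p = cong₂ (λ c x → c + x * basis j p) (clear-cong p) (cong (λ q → (- q) * w)
    (bil-cong G G (clear v) (clear v') (clear v) (clear v') (λ _ _ → refl) clear-cong clear-cong))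
    where
      clear-cong : clear v ≗ clear v'
      clear-cong p = by-cases (p Fin.≟ j)
        where by-cases : Dec (p ≡ j) → clear v p ≡ clear v' p
              by-cases (yes refl) = trans (clear-j v) (sym (clear-j v'))
              by-cases (no p≢j)  = trans (clear-off v p p≢j) (trans (v≗v' p p≢j) (sym (clear-off v' p p≢j)))

  module _ (v v' : Vec) (v≗v' : ∀ p → p ≢ j → π (v p) ≡ π (v' p)) where
    π-clear-cong : ∀ p → π (clear v p) ≡ π (clear v' p)
    π-clear-cong p = by-cases (p Fin.≟ j)
      where by-cases : Dec (p ≡ j) → π (clear v p) ≡ π (clear v' p)
            by-cases (yes refl) = cong π (trans (clear-j v) (sym (clear-j v')))
            by-cases (no p≢j)  = trans (cong π (clear-off v p p≢j)) (trans (v≗v' p p≢j) (cong π (sym (clear-off v' p p≢j))))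

    π-Q-clear-cong : π (bil (clear v) (clear v)) ≡ π (bil (clear v') (clear v'))
    π-Q-clear-cong = begin
      π (bil (clear v) (clear v))              ≡⟨ π-Qform (clear v) ⟩
      Qform 1 ν δ (π z) (πv (clear v))         ≡⟨ R₂.bil-cong G₂ G₂ (πv (clear v)) (πv (clear v')) (πv (clear v)) (πv (clear v'))
                                                   (λ _ _ → refl) π-clear-cong π-clear-cong ⟩
      Qform 1 ν δ (π z) (πv (clear v'))        ≡⟨ π-Qform (clear v') ⟨
      π (bil (clear v') (clear v'))            ∎

    π-forced-cong : π (forced v) ≡ π (forced v')
    π-forced-cong = begin
      π ((- bil (clear v) (clear v)) * w)          ≡⟨ π-* (- bil (clear v) (clear v)) w ⟩
      π (- bil (clear v) (clear v)) R₂.* π w       ≡⟨ cong (R₂._* π w) (π-neg _) ⟩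
      R₂.- π (bil (clear v) (clear v)) R₂.* π w    ≡⟨ cong (λ q → R₂.- q R₂.* π w) π-Q-clear-cong ⟩
      R₂.- π (bil (clear v') (clear v')) R₂.* π w  ≡⟨ cong (R₂._* π w) (π-neg _) ⟨
      π (- bil (clear v') (clear v')) R₂.* π w     ≡⟨ π-* (- bil (clear v') (clear v')) w ⟨
      π ((- bil (clear v') (clear v')) * w)        ∎

    π-complete-cong : ∀ p → π (complete v p) ≡ π (complete v' p)
    π-complete-cong p = begin
      π (clear v p + forced v * basis j p)                  ≡⟨ π-+ (clear v p) _ ⟩
      π (clear v p) R₂.+ π (forced v * basis j p)           ≡⟨ cong₂ R₂._+_ (π-clear-cong p) (π-* (forced v) _) ⟩
      π (clear v' p) R₂.+ π (forced v) R₂.* π (basis j p)   ≡⟨ cong (λ x → π (clear v' p) R₂.+ x R₂.* π (basis j p)) π-forced-cong ⟩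
      π (clear v' p) R₂.+ π (forced v') R₂.* π (basis j p)  ≡⟨ cong (π (clear v' p) R₂.+_) (π-* (forced v') _) ⟨
      π (clear v' p) R₂.+ π (forced v' * basis j p)         ≡⟨ π-+ (clear v' p) _ ⟨
      π (clear v' p + forced v' * basis j p)                ∎

-- Fix a hyperbolic
-- unit coordinate i of a and its partner j.  The classes in the fibre are
-- represented by the completions of a + 2t, where t assigns a number below
-- 2^(k-1) to each of the d - 2 coordinates other than i and j.
module Fibre (n' ν δ : ℕ) (z : Z (ℕ.suc n')) (a : Tup (ℕ.suc n') (2 ℕ.* ν ℕ.+ δ))
             (Qa≡0 : Qform (ℕ.suc n') ν δ z a ≡ zeroZ (ℕ.suc n'))
             (i : Fin (2 ℕ.* ν ℕ.+ δ)) (i<2ν : toℕ i ℕ.< 2 ℕ.* ν) (ai-unit : IsUnit (a i)) where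
  open Reduction n'
  open R
  open Form k ν δ z using (d; bil; bil-scale)
  open Completion n' ν δ z i i<2ν (a i) (proj₁ ai-unit) (proj₂ ai-unit)
  open Complement (complement i j i≢j)
  open Mod2
  open ≡-Reasoning

  w : Z k
  w = proj₁ ai-unit

  Halves : Set
  Halves = Fin (d ∸ 2) → Fin (2 ℕ.^ n')

  lift : Halves → Vec
  lift t p = shift (p Fin.≟ i) (p Fin.≟ j)
    where shift : Dec (p ≡ i) → Dec (p ≡ j) → Z k
          shift (no p≢i) (no p≢j) = a p + double (t (preimage p p≢i p≢j))
          shift _        _        = a p

  lift-i : ∀ t → lift t i ≡ a i
  lift-i t with i Fin.≟ i
  ... | yes _   = refl
  ... | no  i≢i = ⊥-elim (i≢i refl)

  lift-off : ∀ t p (p≢i : p ≢ i) (p≢j : p ≢ j) → lift t p ≡ a p + double (t (preimage p p≢i p≢j))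
  lift-off t p p≢i p≢j with p Fin.≟ i | p Fin.≟ j
  ... | yes p≡i | _       = ⊥-elim (p≢i p≡i)
  ... | no  _   | yes p≡j = ⊥-elim (p≢j p≡j)
  ... | no p≢i' | no p≢j' = cong (λ q → a p + double (t q)) (preimage-irrelevant p p≢i' p≢j' p≢i p≢j)

  lift-embed : ∀ t q → lift t (embed q) ≡ a (embed q) + double (t q)
  lift-embed t q = trans (lift-off t (embed q) (embed≢i q) (embed≢j q))
                         (cong (λ q' → a (embed q) + double (t q')) (preimage-embed q (embed≢i q) (embed≢j q)))

  lift-cong : ∀ t t' → t ≗ t' → lift t ≗ lift t'
  lift-cong t t' t≗t' p with p Fin.≟ i | p Fin.≟ j
  ... | yes _   | _       = refl
  ... | no  _   | yes _   = refl
  ... | no p≢i  | no p≢j  = cong (λ h → a p + double h) (t≗t' _)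

  π-lift : ∀ t p → π (lift t p) ≡ π (a p)
  π-lift t p with p Fin.≟ i | p Fin.≟ j
  ... | yes _   | _       = refl
  ... | no  _   | yes _   = refl
  ... | no p≢i  | no p≢j  = trans (π-+ (a p) _) (trans (cong (π (a p) R₂.+_) (double-even _)) (R₂.+-identityʳ (π (a p))))

  rep : Halves → Vec
  rep t = complete (lift t)

  rep-i : ∀ t → rep t i ≡ a i
  rep-i t = trans (complete-off (lift t) i i≢j) (lift-i t)

  rep-vertex : ∀ t → IsVertex k ν δ z (rep t)
  rep-vertex t = (i , subst IsUnit (sym (rep-i t)) ai-unit) , complete-isotropic (lift t) (lift-i t)

  rep-cong : ∀ t t' → t ≗ t' → rep t ≗ rep t'
  rep-cong t t' t≗t' = complete-cong (lift t) (lift t') (λ p _ → lift-cong t t' t≗t' p)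

  π-rep : ∀ t p → π (rep t p) ≡ π (a p)
  π-rep t p = trans (π-complete-cong (lift t) a (λ p _ → π-lift t p) p)
                    (cong π (complete-isotropic-fixed a refl Qa≡0 p))

  -- distinct t give inequivalent representatives: the scalar is 1 at the
  -- coordinate i, and the coordinates embed q then recover t q
  rep-injective : ∀ t t' → rep t ∼ rep t' → t ≗ t'
  rep-injective t t' (l , _ , rep≡l*rep) q = double-injective (t q) (t' q) (∙-cancelˡ (a (embed q)) _ _ (begin
    a (embed q) + double (t q)    ≡⟨ lift-embed t q ⟨
    lift t (embed q)              ≡⟨ complete-off (lift t) (embed q) (embed≢j q) ⟨
    rep t (embed q)               ≡⟨ rep≗rep (embed q) ⟩
    rep t' (embed q)              ≡⟨ complete-off (lift t') (embed q) (embed≢j q) ⟩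
    lift t' (embed q)             ≡⟨ lift-embed t' q ⟩
    a (embed q) + double (t' q)   ∎))
    where
      1≡l : 1# ≡ l
      1≡l = unit-cancel 1# l (a i) w (proj₂ ai-unit)
              (trans (*-identityˡ (a i)) (trans (sym (rep-i t)) (trans (rep≡l*rep i) (cong (l *_) (rep-i t')))))
      rep≗rep : rep t ≗ rep t'
      rep≗rep p = trans (rep≡l*rep p) (trans (cong (_* rep t' p) (sym 1≡l)) (*-identityˡ (rep t' p)))

  -- every vertex b in the fibre is equivalent to a representative: rescale b
  -- so that b_i = a_i; then b - a is even, and b is the completion of its
  -- coordinates off j
  module Cover (b : Vec) (Qb≡0 : bil b b ≡ 0#) (πa≗πb : ∀ p → π (a p) ≡ π (b p)) where
    bi-unit : IsUnit (b i)
    bi-unit = odd⇒unit (b i) (trans (sym (πa≗πb i)) (unit⇒odd (a i) ai-unit))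

    wb : Z k
    wb = proj₁ bi-unit

    μ : Z k
    μ = a i * wb

    b' : Vec
    b' p = μ * b p

    b'-i : b' i ≡ a i
    b'-i = begin
      a i * wb * b i     ≡⟨ *-assoc (a i) wb (b i) ⟩
      a i * (wb * b i)   ≡⟨ cong (a i *_) (trans (*-comm wb (b i)) (proj₂ bi-unit)) ⟩
      a i * 1#           ≡⟨ *-identityʳ (a i) ⟩
      a i                ∎

    Qb'≡0 : bil b' b' ≡ 0#
    Qb'≡0 = trans (bil-scale μ b) (trans (cong (μ * μ *_) Qb≡0) (zeroʳ (μ * μ)))

    π-b' : ∀ p → π (b' p) ≡ π (a p)
    π-b' p = begin
      π (μ * b p)                         ≡⟨ π-* μ (b p) ⟩
      π μ R₂.* π (b p)                    ≡⟨ cong (R₂._* π (b p)) (trans (π-* (a i) wb) (cong₂ R₂._*_ πai≡1 πwb≡1)) ⟩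
      oneZ 1 R₂.* oneZ 1 R₂.* π (b p)     ≡⟨ R₂.*-identityˡ (π (b p)) ⟩
      π (b p)                             ≡⟨ πa≗πb p ⟨
      π (a p)                             ∎
      where
        πai≡1 : π (a i) ≡ oneZ 1
        πai≡1 = unit⇒odd (a i) ai-unit
        πwb≡1 : π wb ≡ oneZ 1
        πwb≡1 = unit⇒odd wb (b i , trans (*-comm wb (b i)) (proj₂ bi-unit))

    difference-even : ∀ p → π (b' p + - a p) ≡ zeroZ 1
    difference-even p = begin
      π (b' p + - a p)          ≡⟨ π-+ (b' p) (- a p) ⟩
      π (b' p) R₂.+ π (- a p)   ≡⟨ cong (R₂._+ π (- a p)) (π-b' p) ⟩
      π (a p) R₂.+ π (- a p)    ≡⟨ π-+ (a p) (- a p) ⟨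
      π (a p + - a p)           ≡⟨ trans (cong π (-‿inverseʳ (a p))) (π-fromNat 0) ⟩
      zeroZ 1                   ∎

    halving : ∀ q → ∃ λ h → b' (embed q) + - a (embed q) ≡ double h
    halving q = even⇒double (b' (embed q) + - a (embed q)) (difference-even (embed q))

    t : Halves
    t q = proj₁ (halving q)

    lift≡b' : ∀ p → p ≢ j → lift t p ≡ b' p
    lift≡b' p p≢j = by-cases (p Fin.≟ i)
      where
        by-cases : Dec (p ≡ i) → lift t p ≡ b' p
        by-cases (yes refl) = trans (lift-i t) (sym b'-i)
        by-cases (no p≢i) = begin
          lift t p                     ≡⟨ lift-off t p p≢i p≢j ⟩
          a p + double (t q)           ≡⟨ cong (a p +_) (subst (λ p' → b' p' + - a p' ≡ double (t q))
                                                               (embed-preimage p p≢i p≢j) (proj₂ (halving q))) ⟨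
          a p + (b' p + - a p)         ≡⟨ cong (a p +_) (+-comm (b' p) (- a p)) ⟩
          a p + (- a p + b' p)         ≡⟨ +-assoc (a p) (- a p) (b' p) ⟨
          a p + - a p + b' p           ≡⟨ cong (_+ b' p) (-‿inverseʳ (a p)) ⟩
          0# + b' p                    ≡⟨ +-identityˡ (b' p) ⟩
          b' p                         ∎
          where q : Fin (d ∸ 2)
                q = preimage p p≢i p≢j

    rep≗b' : rep t ≗ b'
    rep≗b' p = trans (complete-cong (lift t) b' lift≡b' p) (complete-isotropic-fixed b' b'-i Qb'≡0 p)

    covered : b ∼ rep t
    covered = l , (μ , lμ≡1) , λ p → sym (begin
      l * rep t p      ≡⟨ cong (l *_) (rep≗b' p) ⟩
      l * (μ * b p)    ≡⟨ *-assoc l μ (b p) ⟨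
      l * μ * b p      ≡⟨ cong (_* b p) lμ≡1 ⟩
      1# * b p         ≡⟨ *-identityˡ (b p) ⟩
      b p              ∎)
      where
        l : Z k
        l = b i * w
        lμ≡1 : l * μ ≡ 1#
        lμ≡1 = begin
          b i * w * (a i * wb)   ≡⟨ solve 4 (λ x y u v → x :* y :* (u :* v) := u :* y :* (x :* v)) refl (b i) w (a i) wb ⟩
          a i * w * (b i * wb)   ≡⟨ cong₂ _*_ (proj₂ ai-unit) (proj₂ bi-unit) ⟩
          1# * 1#                ≡⟨ *-identityˡ 1# ⟩
          1#                     ∎

  open Digits n' (d ∸ 2)

  classes : NumClasses (λ b → IsVertex k ν δ z b × (πv a ∼ πv b)) (2 ℕ.^ (n' ℕ.* (d ∸ 2)))
  classes = representative , in-fibre , inequivalent , covers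
    where
      representative : Fin (2 ℕ.^ (n' ℕ.* (d ∸ 2))) → Vec
      representative m = rep (decode m)

      in-fibre : ∀ m → IsVertex k ν δ z (representative m) × (πv a ∼ πv (representative m))
      in-fibre m = rep-vertex (decode m) ,
                   (oneZ 1 , one-unit₂ refl , λ p → trans (sym (π-rep (decode m) p)) (sym (R₂.*-identityˡ (π (rep (decode m) p)))))

      inequivalent : ∀ m l → representative m ∼ representative l → m ≡ l
      inequivalent m l rep∼rep = decode-injective m l (rep-injective (decode m) (decode l) rep∼rep)

      covers : ∀ b → IsVertex k ν δ z b × (πv a ∼ πv b) → ∃ λ m → b ∼ representative m
      covers b (b-vertex , l , l-unit , πa≡lπb) = encode t , re-index (Cover.covered b (proj₂ b-vertex) πa≗πb)
        where
          πa≗πb : ∀ p → π (a p) ≡ π (b p)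
          πa≗πb p = trans (πa≡lπb p) (trans (cong (R₂._* π (b p)) (unit₂ l l-unit)) (R₂.*-identityˡ (π (b p))))
          t : Halves
          t = Cover.t b (proj₂ b-vertex) πa≗πb
          re-index : b ∼ rep t → b ∼ representative (encode t)
          re-index (l' , l'-unit , b≡l'rep) = l' , l'-unit , λ p →
            trans (b≡l'rep p) (cong (l' *_) (rep-cong t (decode (encode t)) (λ q → sym (decode-encode t q)) p))

fibre-size : ∀ n' ν δ (z : Z (ℕ.suc n')) → δ ℕ.≤ 2 → IsUnit z →
             (a : Tup (ℕ.suc n') (2 ℕ.* ν ℕ.+ δ)) → IsVertex (ℕ.suc n') ν δ z a →
             NumClasses (λ b → IsVertex (ℕ.suc n') ν δ z b × (πv a ∼ πv b)) (2 ℕ.^ (n' ℕ.* (2 ℕ.* ν ℕ.+ δ ∸ 2)))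
fibre-size n' ν δ z δ≤2 z-unit a a-vertex =
  let (i , i<2ν , ai-unit) = Reduced.hyperbolic-unit n' ν δ z δ≤2 z-unit a a-vertex
  in Fibre.classes n' ν δ z a (proj₂ a-vertex) i i<2ν ai-unit

open import Data.Nat using (_≤_; _*_; _+_; _^_)

lemma2p2 : (n ν δ : ℕ) → 1 ≤ n → 1 ≤ ν → δ ≤ 2 → (z : Z n) → IsUnit z →
    ((a : Tup n (2 * ν + δ)) → IsVertex n ν δ z a →
      NumClasses (λ b → IsVertex n ν δ z b × (πv a ∼ πv b))
        (2 ^ ((n ∸ 1) * (2 * ν + δ ∸ 2))))
    × ((a b : Tup n (2 * ν + δ)) → IsVertex n ν δ z a → IsVertex n ν δ z b →
      (AdjVertices n ν δ z a b ⇔ AdjVertices 1 ν δ (π z) (πv a) (πv b)))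
    × ((a b : Tup n (2 * ν + δ)) → AdjVertices 1 ν δ (π z) (πv a) (πv b) →
      (m₁ m₂ : Tup n (2 * ν + δ)) → (∀ i → IsEven (m₁ i)) → (∀ i → IsEven (m₂ i)) →
      Qform n ν δ z (addV a m₁) ≡ zeroZ n → Qform n ν δ z (addV b m₂) ≡ zeroZ n →
      AdjVertices n ν δ z (addV a m₁) (addV b m₂))
lemma2p2 (ℕ.suc n') ν δ (ℕ.s≤s ℕ.z≤n) _ δ≤2 z z-unit =
  fibre-size n' ν δ z δ≤2 z-unit ,
  Reduced.adjacency-mod-2 n' ν δ z ,
  Reduced.adjacency-lifts n' ν δ z
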